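{- Consider a realization of the directed Chung–Lu random graph with expected degree sequence $(\mathbf{a},\mathbf{b})$. For every positive integer $r$ and every node $y$, the expected number of paths of length $r$ starting at $y$ is at least $b_{y}\big[\frac{\mathbf{a}\cdot\mathbf{b}}{S}\big]^{r-1}$. Furthermore, the expected total number of paths of length $r$ is at least $S\big[\frac{\mathbf{a}\cdot\mathbf{b}}{S}\big]^{r-1}$.
   Context: Directed Chung–Lu model: there are $N$ nodes $1,\dots,N$; $\mathbf{a}=(a_1,\dots,a_N)$ and $\mathbf{b}=(b_1,\dots,b_N)$ are nonnegative integer vectors (expected in-degrees and out-degrees) with $S=\sum_i a_i=\sum_i b_i$ and $\max_{i,j}a_ib_j\le S$. For every ordered pair $(i,j)$ (including $i=j$), the directed edge $i\to j$ is present independently with probability $p_{ij}=\frac{b_ia_j}{S}$. $\mathbf{a}\cdot\mathbf{b}=\sum_i a_ib_i$. A path of length $r$ is a sequence of nodes $(i_0,i_1,\dots,i_r)$ (repetitions of nodes and edges allowed) such that every edge $i_{k-1}\to i_k$ is present; the number of paths is the number of such sequences. -}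

module Defs where

open import Data.Nat as ℕ using (ℕ; zero; suc; NonZero)
open import Data.Bool using (Bool; true; false; if_then_else_)
open import Data.Fin using (Fin)
open import Data.List using (List; []; _∷_; map; concatMap)
open import Data.Vec.Functional as VF using (Vector)
open import Data.Integer using (+_)
open import Data.Rational using (ℚ; _+_; _*_; _-_; _/_; 0ℚ; 1ℚ)

sumℕ : (n : ℕ) → (Fin n → ℕ) → ℕ
sumℕ n f = VF.foldr ℕ._+_ 0 f

sumℚ : (n : ℕ) → (Fin n → ℚ) → ℚ
sumℚ n f = VF.foldr _+_ 0ℚ f

prodℚ : (n : ℕ) → (Fin n → ℚ) → ℚ
prodℚ n f = VF.foldr _*_ 1ℚ f

_^ℚ_ : ℚ → ℕ → ℚ
q ^ℚ zero = 1ℚ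
q ^ℚ suc k = q * (q ^ℚ k)

sumList : List ℚ → ℚ
sumList [] = 0ℚ
sumList (x ∷ xs) = x + sumList xs

allFuns : {A : Set} → (n : ℕ) → List A → List (Fin n → A)
allFuns zero xs = (λ ()) ∷ []
allFuns (suc n) xs = concatMap (λ x → map (λ f → x VF.∷ f) (allFuns n xs)) xs

-- A (realized) directed graph on N nodes: G i j = true iff edge i → j is present
-- (self loops i → i included).
Graph : ℕ → Set
Graph N = Fin N → Fin N → Bool

allGraphs : (N : ℕ) → List (Graph N)
allGraphs N = allFuns N (allFuns N (true ∷ false ∷ []))

dot : (N : ℕ) → (Fin N → ℕ) → (Fin N → ℕ) → ℕ
dot N a b = sumℕ N (λ i → a i ℕ.* b i)

module ChungLu (N : ℕ) (a b : Fin N → ℕ) (S : ℕ) .{{_ : NonZero S}} where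

  p : Fin N → Fin N → ℚ
  p i j = (+ (b i ℕ.* a j)) / S

  weight : Graph N → ℚ
  weight G = prodℚ N (λ i → prodℚ N (λ j →
               if G i j then p i j else (1ℚ - p i j)))

  𝔼 : (Graph N → ℕ) → ℚ
  𝔼 X = sumList (map (λ G → weight G * ((+ X G) / 1)) (allGraphs N))

-- number of paths (i₀ = y, i₁, …, i_r) of length r in G (node/edge repetitions allowed)
pathsFrom : {N : ℕ} → Graph N → ℕ → Fin N → ℕ
pathsFrom G zero y = 1
pathsFrom {N} G (suc r) y = sumℕ N (λ j → if G y j then pathsFrom G r j else 0)

paths : {N : ℕ} → Graph N → ℕ → ℕ
paths {N} G r = sumℕ N (λ y → pathsFrom G r y)

module Submission where

-- Writing P_r(y) for the number of paths of length r starting at y, splitting off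
-- the first step gives  P_{r+1}(y) = ∑_j 1[y → j] · P_r(j).  Each P_r(j) is an
-- increasing function of the graph, so a Harris inequality for a single edge gives
-- E[1[y → j] · P_r(j)] ≥ p y j · E[P_r(j)]: conditioning on the edge y → j, the
-- statistic on the "edge present" branch dominates the one on the "absent" branch.
-- Hence E[P_{r+1}(y)] ≥ ∑_j p y j E[P_r(j)], and induction on r with the identities
-- ∑_j p y j = b_y and ∑_j p y j b_j = b_y (a·b/S) yields E[P_{r+1}(y)] ≥ b_y (a·b/S)^r.
-- Summing over y, with ∑_y b_y = S, bounds the expected total number of paths.

open import Defs
open import Data.Nat as ℕ using (ℕ; zero; suc; NonZero; _∸_; _>_; >-nonZero)
import Data.Nat.Properties as ℕP
open import Data.Bool using (Bool; true; false; if_then_else_)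
open import Data.Fin using (Fin; zero; suc; _≟_)
open import Data.List using (List; []; _∷_; map; concatMap; _++_)
import Data.List.Properties as LP
open import Data.Vec.Functional using (head; tail) renaming (_∷_ to _∷ᶠ_)
open import Data.Product using (_×_; _,_)
open import Data.Integer as ℤ using (+_)
import Data.Integer.Properties as ℤP
open import Data.Rational as ℚ using (ℚ; _/_; _*_; _+_; _-_; _≤_; 0ℚ; 1ℚ; fromℚᵘ)
import Data.Rational.Properties as ℚP
import Data.Rational.Unnormalised as U
import Data.Rational.Unnormalised.Properties as UP
open import Data.Rational.Solver using (module +-*-Solver)
open import Algebra.Bundles using (Ring)
import Algebra.Properties.Semiring.Sum as SemiringSum
open import Relation.Binary.PropositionalEquality
open import Relation.Nullary using (¬_; yes; no)
open import Data.Empty using (⊥-elim)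
open import Function using (_∘_)

fromℚᵘ-homo-+ : ∀ p q → fromℚᵘ (p U.+ q) ≡ fromℚᵘ p + fromℚᵘ q
fromℚᵘ-homo-+ p q = ℚP.toℚᵘ-injective (UP.≃-trans (ℚP.toℚᵘ-fromℚᵘ (p U.+ q))
  (UP.≃-sym (UP.≃-trans (ℚP.toℚᵘ-homo-+ (fromℚᵘ p) (fromℚᵘ q))
                        (UP.+-cong (ℚP.toℚᵘ-fromℚᵘ p) (ℚP.toℚᵘ-fromℚᵘ q)))))

fromℚᵘ-homo-* : ∀ p q → fromℚᵘ (p U.* q) ≡ fromℚᵘ p * fromℚᵘ q
fromℚᵘ-homo-* p q = ℚP.toℚᵘ-injective (UP.≃-trans (ℚP.toℚᵘ-fromℚᵘ (p U.* q))
  (UP.≃-sym (UP.≃-trans (ℚP.toℚᵘ-homo-* (fromℚᵘ p) (fromℚᵘ q))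
                        (UP.*-cong (ℚP.toℚᵘ-fromℚᵘ p) (ℚP.toℚᵘ-fromℚᵘ q)))))

fromℚᵘ-≃ : ∀ p q → p U.≃ q → fromℚᵘ p ≡ fromℚᵘ q
fromℚᵘ-≃ p q = ℚP.fromℚᵘ-cong

/-nonNeg : ∀ k d .{{_ : NonZero d}} → 0ℚ ≤ + k / d
/-nonNeg k d = ℚP.nonNegative⁻¹ (+ k / d) {{ℚP.normalize-nonNeg k d}}

-- By definition of _/_, ι m is the
-- normalisation of the unnormalised fraction ιᵘ m; the identities below are
-- therefore checked in ℚᵘ by cross-multiplication and transported along fromℚᵘ.
ι : ℕ → ℚ
ι m = + m / 1

ιᵘ : ℕ → U.ℚᵘ
ιᵘ m = + m U./ 1

ι-+ : ∀ m n → ι (m ℕ.+ n) ≡ ι m + ι n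
ι-+ m n = begin
  ι (m ℕ.+ n)              ≡⟨ fromℚᵘ-≃ (ιᵘ (m ℕ.+ n)) (ιᵘ m U.+ ιᵘ n) (U.*≡* (cong (ℤ._* + 1) numerators)) ⟩
  fromℚᵘ (ιᵘ m U.+ ιᵘ n)   ≡⟨ fromℚᵘ-homo-+ (ιᵘ m) (ιᵘ n) ⟩
  ι m + ι n                ∎
  where
  open ≡-Reasoning
  numerators : + (m ℕ.+ n) ≡ + m ℤ.* + 1 ℤ.+ + n ℤ.* + 1
  numerators = trans (ℤP.pos-+ m n) (sym (cong₂ ℤ._+_ (ℤP.*-identityʳ (+ m)) (ℤP.*-identityʳ (+ n))))

ι-* : ∀ m n → ι (m ℕ.* n) ≡ ι m * ι n
ι-* m n = begin
  ι (m ℕ.* n)              ≡⟨ fromℚᵘ-≃ (ιᵘ (m ℕ.* n)) (ιᵘ m U.* ιᵘ n) (U.*≡* (cong (ℤ._* + 1) (ℤP.pos-* m n))) ⟩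
  fromℚᵘ (ιᵘ m U.* ιᵘ n)   ≡⟨ fromℚᵘ-homo-* (ιᵘ m) (ιᵘ n) ⟩
  ι m * ι n                ∎
  where open ≡-Reasoning

ι-mono : ∀ {m n} → m ℕ.≤ n → ι m ≤ ι n
ι-mono {m} {n} m≤n = begin
  ι m                 ≡⟨ ℚP.+-identityʳ (ι m) ⟨
  ι m + 0ℚ            ≤⟨ ℚP.+-monoʳ-≤ (ι m) (/-nonNeg (n ∸ m) 1) ⟩
  ι m + ι (n ∸ m)     ≡⟨ ι-+ m (n ∸ m) ⟨
  ι (m ℕ.+ (n ∸ m))   ≡⟨ cong ι (ℕP.m+[n∸m]≡n m≤n) ⟩
  ι n                 ∎
  where open ℚP.≤-Reasoning

/-as-* : ∀ k d .{{_ : NonZero d}} → + k / d ≡ ι k * (+ 1 / d)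
/-as-* k (suc d) = begin
  + k / suc d                       ≡⟨ fromℚᵘ-≃ (+ k U./ suc d) (ιᵘ k U.* 1/d) (U.*≡* cross-multiplied) ⟩
  fromℚᵘ (ιᵘ k U.* 1/d)             ≡⟨ fromℚᵘ-homo-* (ιᵘ k) 1/d ⟩
  ι k * (+ 1 / suc d)               ∎
  where
  open ≡-Reasoning
  1/d : U.ℚᵘ
  1/d = + 1 U./ suc d
  cross-multiplied : + k ℤ.* + (1 ℕ.* suc d) ≡ (+ k ℤ.* + 1) ℤ.* + suc d
  cross-multiplied = cong₂ ℤ._*_ (sym (ℤP.*-identityʳ (+ k))) (cong +_ (ℕP.*-identityˡ (suc d)))

ι*1/ : ∀ d .{{_ : NonZero d}} → ι d * (+ 1 / d) ≡ 1ℚ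
ι*1/ (suc d) = begin
  ι (suc d) * (+ 1 / suc d)   ≡⟨ /-as-* (suc d) (suc d) ⟨
  + suc d / suc d             ≡⟨ fromℚᵘ-≃ (+ suc d U./ suc d) U.1ℚᵘ (U.*≡* (ℤP.*-comm (+ suc d) (+ 1))) ⟩
  1ℚ                          ∎
  where open ≡-Reasoning

∑ : {A : Set} → List A → (A → ℚ) → ℚ
∑ l h = sumList (map h l)

module _ {A : Set} where

  ∑-cong : ∀ (l : List A) {f g : A → ℚ} → (∀ x → f x ≡ g x) → ∑ l f ≡ ∑ l g
  ∑-cong []      f≗g = refl
  ∑-cong (x ∷ l) f≗g = cong₂ _+_ (f≗g x) (∑-cong l f≗g)

  ∑-mono : ∀ (l : List A) {f g : A → ℚ} → (∀ x → f x ≤ g x) → ∑ l f ≤ ∑ l g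
  ∑-mono []      f≤g = ℚP.≤-refl
  ∑-mono (x ∷ l) f≤g = ℚP.+-mono-≤ (f≤g x) (∑-mono l f≤g)

  ∑-zero : ∀ (l : List A) → ∑ l (λ _ → 0ℚ) ≡ 0ℚ
  ∑-zero []      = refl
  ∑-zero (x ∷ l) = trans (ℚP.+-identityˡ _) (∑-zero l)

  ∑-+ : ∀ (l : List A) (f g : A → ℚ) → ∑ l (λ x → f x + g x) ≡ ∑ l f + ∑ l g
  ∑-+ []      f g = sym (ℚP.+-identityˡ 0ℚ)
  ∑-+ (x ∷ l) f g = trans (cong (λ t → f x + g x + t) (∑-+ l f g)) (interchange (f x) (g x) (∑ l f) (∑ l g))
    where
    open +-*-Solver
    interchange : ∀ a b c d → a + b + (c + d) ≡ a + c + (b + d)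
    interchange = solve 4 (λ a b c d → a :+ b :+ (c :+ d) := a :+ c :+ (b :+ d)) refl

  ∑-*ˡ : ∀ (l : List A) c (f : A → ℚ) → ∑ l (λ x → c * f x) ≡ c * ∑ l f
  ∑-*ˡ []      c f = sym (ℚP.*-zeroʳ c)
  ∑-*ˡ (x ∷ l) c f = trans (cong (λ t → c * f x + t) (∑-*ˡ l c f)) (sym (ℚP.*-distribˡ-+ c (f x) (∑ l f)))

  ∑-average-const : ∀ (l : List A) (w : A → ℚ) c → ∑ l w ≡ 1ℚ → ∑ l (λ x → w x * c) ≡ c
  ∑-average-const l w c total = begin
    ∑ l (λ x → w x * c)   ≡⟨ ∑-cong l (λ x → ℚP.*-comm (w x) c) ⟩
    ∑ l (λ x → c * w x)   ≡⟨ ∑-*ˡ l c w ⟩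
    c * ∑ l w             ≡⟨ cong (c *_) total ⟩
    c * 1ℚ                ≡⟨ ℚP.*-identityʳ c ⟩
    c                     ∎
    where open ≡-Reasoning

  ∑-++ : ∀ (l m : List A) (f : A → ℚ) → ∑ (l ++ m) f ≡ ∑ l f + ∑ m f
  ∑-++ l m f = begin
    sumList (map f (l ++ m))          ≡⟨ cong sumList (LP.map-++ f l m) ⟩
    sumList (map f l ++ map f m)      ≡⟨ sumList-++ (map f l) (map f m) ⟩
    ∑ l f + ∑ m f                     ∎
    where
    open ≡-Reasoning
    sumList-++ : ∀ xs ys → sumList (xs ++ ys) ≡ sumList xs + sumList ys
    sumList-++ []       ys = sym (ℚP.+-identityˡ _)
    sumList-++ (x ∷ xs) ys = trans (cong (λ t → x + t) (sumList-++ xs ys)) (sym (ℚP.+-assoc x _ _))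

module _ {A B : Set} where

  ∑-map : ∀ (k : A → B) (l : List A) (h : B → ℚ) → ∑ (map k l) h ≡ ∑ l (h ∘ k)
  ∑-map k l h = cong sumList (sym (LP.map-∘ l))

  ∑-concatMap : ∀ (k : A → List B) (l : List A) (h : B → ℚ) → ∑ (concatMap k l) h ≡ ∑ l (λ x → ∑ (k x) h)
  ∑-concatMap k []      h = refl
  ∑-concatMap k (x ∷ l) h = trans (∑-++ (k x) (concatMap k l) h) (cong (λ t → ∑ (k x) h + t) (∑-concatMap k l h))

  ∑-swap : ∀ (l : List A) (m : List B) (h : A → B → ℚ) → ∑ l (λ x → ∑ m (h x)) ≡ ∑ m (λ y → ∑ l (λ x → h x y))
  ∑-swap []      m h = sym (∑-zero m)
  ∑-swap (x ∷ l) m h = trans (cong (λ t → ∑ m (h x) + t) (∑-swap l m h)) (sym (∑-+ m (h x) (λ y → ∑ l (λ x → h x y))))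

-- Sums over Fin n, from the library's semiring summation (sumℚ n f is its sum f).
open SemiringSum (Ring.semiring ℚP.+-*-ring) public using (*-distribˡ-sum; *-distribʳ-sum) renaming (sum-cong-≗ to sumℚ-cong)
open SemiringSum ℕP.+-*-semiring public using () renaming (sum-cong-≗ to sumℕ-cong)

sumℚ-mono : ∀ n {f g : Fin n → ℚ} → (∀ j → f j ≤ g j) → sumℚ n f ≤ sumℚ n g
sumℚ-mono zero    f≤g = ℚP.≤-refl
sumℚ-mono (suc n) f≤g = ℚP.+-mono-≤ (f≤g zero) (sumℚ-mono n (f≤g ∘ suc))

sumℕ-mono : ∀ n {f g : Fin n → ℕ} → (∀ j → f j ℕ.≤ g j) → sumℕ n f ℕ.≤ sumℕ n g
sumℕ-mono zero    f≤g = ℕ.z≤n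
sumℕ-mono (suc n) f≤g = ℕP.+-mono-≤ (f≤g zero) (sumℕ-mono n (f≤g ∘ suc))

ι-sum : ∀ n (f : Fin n → ℕ) → ι (sumℕ n f) ≡ sumℚ n (ι ∘ f)
ι-sum zero    f = refl
ι-sum (suc n) f = trans (ι-+ (f zero) _) (cong (λ t → ι (f zero) + t) (ι-sum n (f ∘ suc)))

*-nonNeg : ∀ {x y} → 0ℚ ≤ x → 0ℚ ≤ y → 0ℚ ≤ x * y
*-nonNeg {x} {y} 0≤x 0≤y =
  ℚP.nonNegative⁻¹ _ {{ℚP.nonNeg*nonNeg⇒nonNeg x {{ℚ.nonNegative 0≤x}} y {{ℚ.nonNegative 0≤y}}}}

*-monoˡ-nonNeg : ∀ {c x y} → 0ℚ ≤ c → x ≤ y → c * x ≤ c * y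
*-monoˡ-nonNeg {c} 0≤c = ℚP.*-monoˡ-≤-nonNeg c {{ℚ.nonNegative 0≤c}}

prodℚ-nonNeg : ∀ n (f : Fin n → ℚ) → (∀ i → 0ℚ ≤ f i) → 0ℚ ≤ prodℚ n f
prodℚ-nonNeg zero    f 0≤f = ℚP.nonNegative⁻¹ 1ℚ
prodℚ-nonNeg (suc n) f 0≤f = *-nonNeg (0≤f zero) (prodℚ-nonNeg n (f ∘ suc) (0≤f ∘ suc))

-- Replace the k-th entry of a vector.  Defined by recursion on k so that an
-- update below a cons computes to a cons: update (suc k) x (a ∷ᶠ f) = a ∷ᶠ update k x f.
update : ∀ {A : Set} {n} → Fin n → A → (Fin n → A) → Fin n → A
update zero    x f = x ∷ᶠ tail f
update (suc k) x f = head f ∷ᶠ update k x (tail f)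

module _ {A : Set} where

  update-same : ∀ {n} (k : Fin n) (x : A) f → update k x f k ≡ x
  update-same zero    x f = refl
  update-same (suc k) x f = update-same k x (tail f)

  update-other : ∀ {n} (k : Fin n) (x : A) f i → ¬ i ≡ k → update k x f i ≡ f i
  update-other zero    x f zero    i≢k = ⊥-elim (i≢k refl)
  update-other zero    x f (suc i) i≢k = refl
  update-other (suc k) x f zero    i≢k = refl
  update-other (suc k) x f (suc i) i≢k = update-other k x (tail f) i (i≢k ∘ cong suc)

  update-overwrite : ∀ {n} (k : Fin n) (y z : A) f i → update k y (update k z f) i ≡ update k y f i
  update-overwrite zero    y z f zero    = refl
  update-overwrite zero    y z f (suc i) = refl
  update-overwrite (suc k) y z f zero    = refl
  update-overwrite (suc k) y z f (suc i) = update-overwrite k y z (tail f) i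

-- The product measure on Fin n → A, where A is enumerated by the list xs and
-- coordinate i is distributed according to the weights μ i : A → ℚ.
module ProductMeasure {A : Set} (xs : List A) where

  Weights : ℕ → Set
  Weights n = Fin n → A → ℚ

  weight : ∀ n → Weights n → (Fin n → A) → ℚ
  weight n μ f = prodℚ n (λ i → μ i (f i))

  Ex : ∀ n → Weights n → ((Fin n → A) → ℚ) → ℚ
  Ex n μ X = ∑ (allFuns n xs) (λ f → weight n μ f * X f)

  Normalised : ∀ {n} → Weights n → Set
  Normalised μ = ∀ i → ∑ xs (μ i) ≡ 1ℚ

  Ex-cons : ∀ n μ X → Ex (suc n) μ X ≡ ∑ xs (λ a → μ zero a * Ex n (μ ∘ suc) (λ f → X (a ∷ᶠ f)))
  Ex-cons n μ X = begin
    Ex (suc n) μ X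
      ≡⟨ ∑-concatMap (λ a → map (a ∷ᶠ_) (allFuns n xs)) xs _ ⟩
    ∑ xs (λ a → ∑ (map (a ∷ᶠ_) (allFuns n xs)) (λ f → weight (suc n) μ f * X f))
      ≡⟨ ∑-cong xs (λ a → ∑-map (a ∷ᶠ_) (allFuns n xs) _) ⟩
    ∑ xs (λ a → ∑ (allFuns n xs) (λ f → μ zero a * weight n (μ ∘ suc) f * X (a ∷ᶠ f)))
      ≡⟨ ∑-cong xs (λ a → ∑-cong (allFuns n xs) (λ f → ℚP.*-assoc (μ zero a) _ _)) ⟩
    ∑ xs (λ a → ∑ (allFuns n xs) (λ f → μ zero a * (weight n (μ ∘ suc) f * X (a ∷ᶠ f))))
      ≡⟨ ∑-cong xs (λ a → ∑-*ˡ (allFuns n xs) (μ zero a) _) ⟩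
    ∑ xs (λ a → μ zero a * Ex n (μ ∘ suc) (λ f → X (a ∷ᶠ f)))
      ∎
    where open ≡-Reasoning

  Ex-cong : ∀ n μ {X Y} → (∀ f → X f ≡ Y f) → Ex n μ X ≡ Ex n μ Y
  Ex-cong n μ X≗Y = ∑-cong (allFuns n xs) (λ f → cong (weight n μ f *_) (X≗Y f))

  Ex-mono : ∀ n μ → (∀ i a → 0ℚ ≤ μ i a) → ∀ {X Y} → (∀ f → X f ≤ Y f) → Ex n μ X ≤ Ex n μ Y
  Ex-mono n μ 0≤μ X≤Y = ∑-mono (allFuns n xs) (λ f →
    *-monoˡ-nonNeg (prodℚ-nonNeg n _ (λ i → 0≤μ i (f i))) (X≤Y f))

  Ex-zero : ∀ n μ → Ex n μ (λ _ → 0ℚ) ≡ 0ℚ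
  Ex-zero n μ = trans (∑-cong (allFuns n xs) (λ f → ℚP.*-zeroʳ (weight n μ f))) (∑-zero (allFuns n xs))

  Ex-+ : ∀ n μ X Y → Ex n μ (λ f → X f + Y f) ≡ Ex n μ X + Ex n μ Y
  Ex-+ n μ X Y = trans (∑-cong (allFuns n xs) (λ f → ℚP.*-distribˡ-+ (weight n μ f) (X f) (Y f)))
                       (∑-+ (allFuns n xs) _ _)

  Ex-sum : ∀ n μ m (F : Fin m → (Fin n → A) → ℚ) → Ex n μ (λ f → sumℚ m (λ j → F j f)) ≡ sumℚ m (λ j → Ex n μ (F j))
  Ex-sum n μ zero    F = Ex-zero n μ
  Ex-sum n μ (suc m) F = trans (Ex-+ n μ (F zero) _) (cong (λ t → Ex n μ (F zero) + t) (Ex-sum n μ m (F ∘ suc)))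

  Ex-one : ∀ n μ → Normalised μ → Ex n μ (λ _ → 1ℚ) ≡ 1ℚ
  Ex-one zero    μ norm = refl
  Ex-one (suc n) μ norm = begin
    Ex (suc n) μ (λ _ → 1ℚ)                          ≡⟨ Ex-cons n μ _ ⟩
    ∑ xs (λ a → μ zero a * Ex n (μ ∘ suc) (λ _ → 1ℚ)) ≡⟨ ∑-average-const xs (μ zero) _ (norm zero) ⟩
    Ex n (μ ∘ suc) (λ _ → 1ℚ)                        ≡⟨ Ex-one n (μ ∘ suc) (norm ∘ suc) ⟩
    1ℚ                                                ∎
    where open ≡-Reasoning

  Ex-resample : ∀ n μ (k : Fin n) X → ∑ xs (μ k) ≡ 1ℚ →
                Ex n μ X ≡ ∑ xs (λ x → μ k x * Ex n μ (X ∘ update k x))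
  Ex-resample (suc n) μ zero X total = begin
    Ex (suc n) μ X
      ≡⟨ Ex-cons n μ X ⟩
    ∑ xs (λ x → μ zero x * Ex n (μ ∘ suc) (λ f → X (x ∷ᶠ f)))
      ≡⟨ ∑-cong xs (λ x → cong (μ zero x *_) (sym (forget-first x))) ⟩
    ∑ xs (λ x → μ zero x * Ex (suc n) μ (X ∘ update zero x))
      ∎
    where
    open ≡-Reasoning
    -- after setting the first coordinate, its distribution is irrelevant
    forget-first : ∀ x → Ex (suc n) μ (X ∘ update zero x) ≡ Ex n (μ ∘ suc) (λ f → X (x ∷ᶠ f))
    forget-first x = trans (Ex-cons n μ _) (∑-average-const xs (μ zero) _ total)
  Ex-resample (suc n) μ (suc k) X total = begin
    Ex (suc n) μ X
      ≡⟨ Ex-cons n μ X ⟩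
    ∑ xs (λ a → μ zero a * Ex n ν (λ f → X (a ∷ᶠ f)))
      ≡⟨ ∑-cong xs (λ a → cong (μ zero a *_) (Ex-resample n ν k (λ f → X (a ∷ᶠ f)) total)) ⟩
    ∑ xs (λ a → μ zero a * ∑ xs (λ x → μ (suc k) x * Y a x))
      ≡⟨ ∑-cong xs (λ a → sym (∑-*ˡ xs (μ zero a) _)) ⟩
    ∑ xs (λ a → ∑ xs (λ x → μ zero a * (μ (suc k) x * Y a x)))
      ≡⟨ ∑-swap xs xs _ ⟩
    ∑ xs (λ x → ∑ xs (λ a → μ zero a * (μ (suc k) x * Y a x)))
      ≡⟨ ∑-cong xs (λ x → ∑-cong xs (λ a → swap-factors (μ zero a) (μ (suc k) x) (Y a x))) ⟩
    ∑ xs (λ x → ∑ xs (λ a → μ (suc k) x * (μ zero a * Y a x)))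
      ≡⟨ ∑-cong xs (λ x → ∑-*ˡ xs (μ (suc k) x) _) ⟩
    ∑ xs (λ x → μ (suc k) x * ∑ xs (λ a → μ zero a * Y a x))
      ≡⟨ ∑-cong xs (λ x → cong (μ (suc k) x *_) (sym (Ex-cons n μ (X ∘ update (suc k) x)))) ⟩
    ∑ xs (λ x → μ (suc k) x * Ex (suc n) μ (X ∘ update (suc k) x))
      ∎
    where
    open ≡-Reasoning
    ν : Weights n
    ν = μ ∘ suc
    Y : A → A → ℚ
    Y a x = Ex n ν (λ f → X (a ∷ᶠ update k x f))
    open +-*-Solver
    swap-factors : ∀ u v w → u * (v * w) ≡ v * (u * w)
    swap-factors = solve 3 (λ u v w → u :* (v :* w) := v :* (u :* w)) refl

Extensional : ∀ {N} → (Graph N → ℚ) → Set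
Extensional {N} X = ∀ G G' → (∀ i j → G i j ≡ G' i j) → X G ≡ X G'

_⊑_ : ∀ {N} → Graph N → Graph N → Set
G ⊑ G' = ∀ i j → G i j ≡ true → G' i j ≡ true

Increasing : ∀ {N} → (Graph N → ℚ) → Set
Increasing {N} X = ∀ G G' → G ⊑ G' → X G ≤ X G'

setEdge : ∀ {N} → Fin N → Fin N → Bool → Graph N → Graph N
setEdge i j x G = update i (update j x (G i)) G

setEdge-same : ∀ {N} (i j : Fin N) x G → setEdge i j x G i j ≡ x
setEdge-same i j x G = trans (cong (λ row → row j) (update-same i _ G)) (update-same j x (G i))

setEdge-⊑ : ∀ {N} (i j : Fin N) G → setEdge i j false G ⊑ setEdge i j true G
setEdge-⊑ i j G i' j' present with i' ≟ i
... | no i'≢i = trans (elsewhere true) (trans (sym (elsewhere false)) present)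
  where
  elsewhere : ∀ x → setEdge i j x G i' j' ≡ G i' j'
  elsewhere x = cong (λ row → row j') (update-other i _ G i' i'≢i)
... | yes refl with j' ≟ j
...   | yes refl = setEdge-same i j true G
...   | no j'≢j  = trans (in-row true) (trans (sym (in-row false)) present)
  where
  in-row : ∀ x → setEdge i j x G i j' ≡ G i j'
  in-row x = trans (cong (λ row → row j') (update-same i _ G)) (update-other j x (G i) j' j'≢j)

setEdge-update : ∀ {N} (i j : Fin N) x row G i' j' →
                 setEdge i j x (update i row G) i' j' ≡ update i (update j x row) G i' j'
setEdge-update i j x row G i' j' =
  trans (cong (λ r → r j') (update-overwrite i _ row G i'))
        (cong (λ r → update i (update j x r) G i' j') (update-same i row G))

ind : Bool → ℚ
ind b = if b then 1ℚ else 0ℚ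

ι-if : ∀ c v → ι (if c then v else 0) ≡ ind c * ι v
ι-if true  v = sym (ℚP.*-identityˡ (ι v))
ι-if false v = sym (ℚP.*-zeroˡ (ι v))

pathsFrom-ext : ∀ {N} r y (G G' : Graph N) → (∀ i j → G i j ≡ G' i j) → pathsFrom G r y ≡ pathsFrom G' r y
pathsFrom-ext zero    y G G' G≗G' = refl
pathsFrom-ext (suc r) y G G' G≗G' =
  sumℕ-cong (λ j → cong₂ (λ c v → if c then v else 0) (G≗G' y j) (pathsFrom-ext r j G G' G≗G'))

pathsFrom-mono : ∀ {N} r y (G G' : Graph N) → G ⊑ G' → pathsFrom G r y ℕ.≤ pathsFrom G' r y
pathsFrom-mono zero    y G G' G⊑G' = ℕP.≤-refl
pathsFrom-mono {N} (suc r) y G G' G⊑G' = sumℕ-mono N first-step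
  where
  first-step : ∀ j → (if G y j then pathsFrom G r j else 0) ℕ.≤ (if G' y j then pathsFrom G' r j else 0)
  first-step j with G y j in edge
  ... | false = ℕ.z≤n
  ... | true rewrite G⊑G' y j edge = pathsFrom-mono r j G G' G⊑G'

module RandomGraph (N : ℕ) (p : Fin N → Fin N → ℚ)
                   (0≤p : ∀ i j → 0ℚ ≤ p i j) (p≤1 : ∀ i j → p i j ≤ 1ℚ) where

  bools : List Bool
  bools = true ∷ false ∷ []

  rows : List (Fin N → Bool)
  rows = allFuns N bools

  module Rows = ProductMeasure bools
  module Graphs = ProductMeasure rows

  ν : Fin N → Fin N → Bool → ℚ
  ν i j x = if x then p i j else 1ℚ - p i j

  μ : Fin N → (Fin N → Bool) → ℚ
  μ i row = Rows.weight N (ν i) row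

  E : (Graph N → ℚ) → ℚ
  E = Graphs.Ex N μ

  ν-nonNeg : ∀ i j x → 0ℚ ≤ ν i j x
  ν-nonNeg i j true  = 0≤p i j
  ν-nonNeg i j false = begin
    0ℚ                   ≡⟨ ℚP.+-inverseʳ (p i j) ⟨
    p i j - p i j        ≤⟨ ℚP.+-monoˡ-≤ (ℚ.- p i j) (p≤1 i j) ⟩
    1ℚ - p i j           ∎
    where open ℚP.≤-Reasoning

  ν-normalised : ∀ i → Rows.Normalised (ν i)
  ν-normalised i j = solve 1 (λ q → q :+ ((con 1ℚ :- q) :+ con 0ℚ) := con 1ℚ) refl (p i j)
    where open +-*-Solver

  μ-normalised : Graphs.Normalised μ
  μ-normalised i = trans (∑-cong rows (λ row → sym (ℚP.*-identityʳ (μ i row))))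
                         (Rows.Ex-one N (ν i) (ν-normalised i))

  μ-nonNeg : ∀ i row → 0ℚ ≤ μ i row
  μ-nonNeg i row = prodℚ-nonNeg N _ (λ j → ν-nonNeg i j (row j))

  E-mono : ∀ {X Y} → (∀ G → X G ≤ Y G) → E X ≤ E Y
  E-mono = Graphs.Ex-mono N μ μ-nonNeg

  E-edge : ∀ i j X → Extensional X →
           E X ≡ p i j * E (X ∘ setEdge i j true) + (1ℚ - p i j) * E (X ∘ setEdge i j false)
  E-edge i j X ext = begin
    E X
      ≡⟨ Graphs.Ex-resample N μ i X (μ-normalised i) ⟩
    Rows.Ex N (ν i) F
      ≡⟨ Rows.Ex-resample N (ν i) j F (ν-normalised i j) ⟩
    ν i j true * Rows.Ex N (ν i) (F ∘ update j true) + (ν i j false * Rows.Ex N (ν i) (F ∘ update j false) + 0ℚ)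
      ≡⟨ cong₂ (λ u v → p i j * u + v) (condition true) (ℚP.+-identityʳ _) ⟩
    p i j * E (X ∘ setEdge i j true) + (1ℚ - p i j) * Rows.Ex N (ν i) (F ∘ update j false)
      ≡⟨ cong (λ v → p i j * E (X ∘ setEdge i j true) + (1ℚ - p i j) * v) (condition false) ⟩
    p i j * E (X ∘ setEdge i j true) + (1ℚ - p i j) * E (X ∘ setEdge i j false)
      ∎
    where
    open ≡-Reasoning
    -- expectation of X given row i
    F : (Fin N → Bool) → ℚ
    F row = E (X ∘ update i row)
    condition : ∀ x → Rows.Ex N (ν i) (F ∘ update j x) ≡ E (X ∘ setEdge i j x)
    condition x = sym (trans (Graphs.Ex-resample N μ i (X ∘ setEdge i j x) (μ-normalised i))
      (∑-cong rows (λ row → cong (μ i row *_)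
        (Graphs.Ex-cong N μ (λ G → ext _ _ (setEdge-update i j x row G))))))

  E-indicator : ∀ i j Y → Extensional Y → E (λ G → ind (G i j) * Y G) ≡ p i j * E (Y ∘ setEdge i j true)
  E-indicator i j Y ext = begin
    E Z
      ≡⟨ E-edge i j Z (λ G G' G≗G' → cong₂ (λ b y → ind b * y) (G≗G' i j) (ext G G' G≗G')) ⟩
    p i j * E (Z ∘ setEdge i j true) + (1ℚ - p i j) * E (Z ∘ setEdge i j false)
      ≡⟨ cong₂ (λ u v → p i j * u + (1ℚ - p i j) * v) (Graphs.Ex-cong N μ present) (Graphs.Ex-cong N μ absent) ⟩
    p i j * Y⁺ + (1ℚ - p i j) * E (λ _ → 0ℚ)
      ≡⟨ cong (λ v → p i j * Y⁺ + (1ℚ - p i j) * v) (Graphs.Ex-zero N μ) ⟩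
    p i j * Y⁺ + (1ℚ - p i j) * 0ℚ
      ≡⟨ solve 2 (λ q y → q :* y :+ (con 1ℚ :- q) :* con 0ℚ := q :* y) refl (p i j) Y⁺ ⟩
    p i j * Y⁺
      ∎
    where
    open ≡-Reasoning
    open +-*-Solver
    Y⁺ : ℚ
    Y⁺ = E (Y ∘ setEdge i j true)
    Z : Graph N → ℚ
    Z G = ind (G i j) * Y G
    present : ∀ G → Z (setEdge i j true G) ≡ Y (setEdge i j true G)
    present G = trans (cong (λ b → ind b * Y (setEdge i j true G)) (setEdge-same i j true G))
                      (ℚP.*-identityˡ (Y (setEdge i j true G)))
    absent : ∀ G → Z (setEdge i j false G) ≡ 0ℚ
    absent G = trans (cong (λ b → ind b * Y (setEdge i j false G)) (setEdge-same i j false G))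
                     (ℚP.*-zeroˡ (Y (setEdge i j false G)))

  E-≤-present : ∀ i j Y → Extensional Y → Increasing Y → E Y ≤ E (Y ∘ setEdge i j true)
  E-≤-present i j Y ext incr = begin
    E Y                              ≡⟨ E-edge i j Y ext ⟩
    p i j * Y⁺ + (1ℚ - p i j) * Y⁻   ≤⟨ ℚP.+-monoʳ-≤ (p i j * Y⁺) (*-monoˡ-nonNeg (ν-nonNeg i j false) Y⁻≤Y⁺) ⟩
    p i j * Y⁺ + (1ℚ - p i j) * Y⁺   ≡⟨ solve 2 (λ q y → q :* y :+ (con 1ℚ :- q) :* y := y) refl (p i j) Y⁺ ⟩
    Y⁺                               ∎
    where
    open ℚP.≤-Reasoning
    open +-*-Solver
    Y⁺ Y⁻ : ℚ
    Y⁺ = E (Y ∘ setEdge i j true)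
    Y⁻ = E (Y ∘ setEdge i j false)
    Y⁻≤Y⁺ : Y⁻ ≤ Y⁺
    Y⁻≤Y⁺ = E-mono (λ G → incr _ _ (setEdge-⊑ i j G))

  E-edge-correlation : ∀ i j Y → Extensional Y → Increasing Y →
                       p i j * E Y ≤ E (λ G → ind (G i j) * Y G)
  E-edge-correlation i j Y ext incr = begin
    p i j * E Y                        ≤⟨ *-monoˡ-nonNeg (0≤p i j) (E-≤-present i j Y ext incr) ⟩
    p i j * E (Y ∘ setEdge i j true)   ≡⟨ E-indicator i j Y ext ⟨
    E (λ G → ind (G i j) * Y G)        ∎
    where open ℚP.≤-Reasoning

  P : ℕ → Fin N → Graph N → ℚ
  P r y G = ι (pathsFrom G r y)

  E-paths-step : ∀ r y → sumℚ N (λ j → p y j * E (P r j)) ≤ E (P (suc r) y)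
  E-paths-step r y = begin
    sumℚ N (λ j → p y j * E (P r j))
      ≤⟨ sumℚ-mono N (λ j → E-edge-correlation y j (P r j)
           (λ G G' G≗G' → cong ι (pathsFrom-ext r j G G' G≗G'))
           (λ G G' G⊑G' → ι-mono (pathsFrom-mono r j G G' G⊑G'))) ⟩
    sumℚ N (λ j → E (λ G → ind (G y j) * P r j G))
      ≡⟨ Graphs.Ex-sum N μ N (λ j G → ind (G y j) * P r j G) ⟨
    E (λ G → sumℚ N (λ j → ind (G y j) * P r j G))
      ≡⟨ Graphs.Ex-cong N μ (λ G → trans (ι-sum N _)
                                         (sumℚ-cong (λ j → ι-if (G y j) (pathsFrom G r j)))) ⟨
    E (P (suc r) y)
      ∎
    where open ℚP.≤-Reasoning

module ChungLuPaths (N : ℕ) (a b : Fin N → ℕ) (S : ℕ) .{{_ : NonZero S}}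
                    (a-total : sumℕ N a ≡ S) (b-total : sumℕ N b ≡ S)
                    (ab≤S : ∀ i j → a i ℕ.* b j ℕ.≤ S) where

  1/S : ℚ
  1/S = + 1 / S

  p : Fin N → Fin N → ℚ
  p = ChungLu.p N a b S

  p≡ : ∀ i j → p i j ≡ ι (b i) * ι (a j) * 1/S
  p≡ i j = trans (/-as-* (b i ℕ.* a j) S) (cong (_* 1/S) (ι-* (b i) (a j)))

  0≤p : ∀ i j → 0ℚ ≤ p i j
  0≤p i j = /-nonNeg (b i ℕ.* a j) S

  p≤1 : ∀ i j → p i j ≤ 1ℚ
  p≤1 i j = begin
    p i j                    ≡⟨ /-as-* (b i ℕ.* a j) S ⟩
    ι (b i ℕ.* a j) * 1/S    ≤⟨ ℚP.*-monoʳ-≤-nonNeg 1/S {{ℚ.nonNegative (/-nonNeg 1 S)}} (ι-mono bᵢaⱼ≤S) ⟩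
    ι S * 1/S                ≡⟨ ι*1/ S ⟩
    1ℚ                       ∎
    where
    open ℚP.≤-Reasoning
    bᵢaⱼ≤S : b i ℕ.* a j ℕ.≤ S
    bᵢaⱼ≤S = subst (ℕ._≤ S) (ℕP.*-comm (a j) (b i)) (ab≤S j i)

  open RandomGraph N p 0≤p p≤1

  -- The ratio a·b/S by which the expected number of paths grows per step.
  c : ℚ
  c = + dot N a b / S

  ι-total : ∀ (d : Fin N → ℕ) → sumℕ N d ≡ S → sumℚ N (ι ∘ d) ≡ ι S
  ι-total d total = trans (sym (ι-sum N d)) (cong ι total)

  ∑-p : ∀ y (g : Fin N → ℚ) → sumℚ N (λ j → p y j * g j) ≡ ι (b y) * 1/S * sumℚ N (λ j → ι (a j) * g j)
  ∑-p y g = trans (sumℚ-cong (λ j → trans (cong (_* g j) (p≡ y j)) (regroup (ι (b y)) (ι (a j)) 1/S (g j))))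
                  (sym (*-distribˡ-sum (ι (b y) * 1/S) (λ j → ι (a j) * g j)))
    where
    open +-*-Solver
    regroup : ∀ x z w v → x * z * w * v ≡ x * w * (z * v)
    regroup = solve 4 (λ x z w v → x :* z :* w :* v := x :* w :* (z :* v)) refl

  ∑-p-one : ∀ y → sumℚ N (λ j → p y j * 1ℚ) ≡ ι (b y)
  ∑-p-one y = begin
    sumℚ N (λ j → p y j * 1ℚ)                    ≡⟨ ∑-p y (λ _ → 1ℚ) ⟩
    ι (b y) * 1/S * sumℚ N (λ j → ι (a j) * 1ℚ)  ≡⟨ cong (ι (b y) * 1/S *_) ∑-a ⟩
    ι (b y) * 1/S * ι S                          ≡⟨ ℚP.*-assoc (ι (b y)) 1/S (ι S) ⟩
    ι (b y) * (1/S * ι S)                        ≡⟨ cong (ι (b y) *_) (trans (ℚP.*-comm 1/S (ι S)) (ι*1/ S)) ⟩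
    ι (b y) * 1ℚ                                 ≡⟨ ℚP.*-identityʳ (ι (b y)) ⟩
    ι (b y)                                      ∎
    where
    open ≡-Reasoning
    ∑-a : sumℚ N (λ j → ι (a j) * 1ℚ) ≡ ι S
    ∑-a = trans (sumℚ-cong (λ j → ℚP.*-identityʳ (ι (a j)))) (ι-total a a-total)

  ∑-p-b : ∀ y K → sumℚ N (λ j → p y j * (ι (b j) * K)) ≡ ι (b y) * (c * K)
  ∑-p-b y K = begin
    sumℚ N (λ j → p y j * (ι (b j) * K))                    ≡⟨ ∑-p y (λ j → ι (b j) * K) ⟩
    ι (b y) * 1/S * sumℚ N (λ j → ι (a j) * (ι (b j) * K))  ≡⟨ cong (ι (b y) * 1/S *_) ∑-ab ⟩
    ι (b y) * 1/S * (ι (dot N a b) * K)                     ≡⟨ regroup (ι (b y)) 1/S (ι (dot N a b)) K ⟩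
    ι (b y) * (ι (dot N a b) * 1/S * K)                     ≡⟨ cong (λ t → ι (b y) * (t * K)) (/-as-* (dot N a b) S) ⟨
    ι (b y) * (c * K)                                       ∎
    where
    open ≡-Reasoning
    open +-*-Solver
    regroup : ∀ x w d k → x * w * (d * k) ≡ x * (d * w * k)
    regroup = solve 4 (λ x w d k → x :* w :* (d :* k) := x :* (d :* w :* k)) refl
    ∑-ab : sumℚ N (λ j → ι (a j) * (ι (b j) * K)) ≡ ι (dot N a b) * K
    ∑-ab = begin
      sumℚ N (λ j → ι (a j) * (ι (b j) * K))  ≡⟨ sumℚ-cong (λ j → sym (trans (cong (_* K) (ι-* (a j) (b j))) (ℚP.*-assoc (ι (a j)) (ι (b j)) K))) ⟩
      sumℚ N (λ j → ι (a j ℕ.* b j) * K)      ≡⟨ *-distribʳ-sum K (λ j → ι (a j ℕ.* b j)) ⟨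
      sumℚ N (λ j → ι (a j ℕ.* b j)) * K      ≡⟨ cong (_* K) (ι-sum N (λ j → a j ℕ.* b j)) ⟨
      ι (dot N a b) * K                       ∎

  E-pathsFrom : ∀ r y → ι (b y) * c ^ℚ r ≤ E (P (suc r) y)
  E-pathsFrom zero y = begin
    ι (b y) * 1ℚ                        ≡⟨ ℚP.*-identityʳ (ι (b y)) ⟩
    ι (b y)                             ≡⟨ ∑-p-one y ⟨
    sumℚ N (λ j → p y j * 1ℚ)           ≡⟨ sumℚ-cong (λ j → cong (p y j *_) (Graphs.Ex-one N μ μ-normalised)) ⟨
    sumℚ N (λ j → p y j * E (P 0 j))    ≤⟨ E-paths-step 0 y ⟩
    E (P 1 y)                           ∎
    where open ℚP.≤-Reasoning
  E-pathsFrom (suc r) y = begin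
    ι (b y) * (c * c ^ℚ r)                      ≡⟨ ∑-p-b y (c ^ℚ r) ⟨
    sumℚ N (λ j → p y j * (ι (b j) * c ^ℚ r))   ≤⟨ sumℚ-mono N (λ j → *-monoˡ-nonNeg (0≤p y j) (E-pathsFrom r j)) ⟩
    sumℚ N (λ j → p y j * E (P (suc r) j))      ≤⟨ E-paths-step (suc r) y ⟩
    E (P (suc (suc r)) y)                       ∎
    where open ℚP.≤-Reasoning

  E-paths : ∀ r → ι S * c ^ℚ r ≤ E (λ G → ι (paths G (suc r)))
  E-paths r = begin
    ι S * c ^ℚ r                                ≡⟨ cong (_* c ^ℚ r) (ι-total b b-total) ⟨
    sumℚ N (ι ∘ b) * c ^ℚ r                     ≡⟨ *-distribʳ-sum (c ^ℚ r) (ι ∘ b) ⟩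
    sumℚ N (λ y → ι (b y) * c ^ℚ r)             ≤⟨ sumℚ-mono N (E-pathsFrom r) ⟩
    sumℚ N (λ y → E (P (suc r) y))              ≡⟨ Graphs.Ex-sum N μ N (λ y → P (suc r) y) ⟨
    E (λ G → sumℚ N (λ y → P (suc r) y G))      ≡⟨ Graphs.Ex-cong N μ (λ G → ι-sum N (λ y → pathsFrom G (suc r) y)) ⟨
    E (λ G → ι (paths G (suc r)))               ∎
    where open ℚP.≤-Reasoning

-- Write r = r' + 1.  Since + m / 1 is ι m and ChungLu.𝔼 of a count X is by
-- definition E (ι ∘ X), the two claims are E-pathsFrom r' and E-paths r'.
lemma2 : (N : ℕ) (a b : Fin N → ℕ) (S : ℕ) (S>0 : S > 0)
    → sumℕ N a ≡ S → sumℕ N b ≡ S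
    → (∀ i j → a i ℕ.* b j ℕ.≤ S)
    → (r : ℕ) → 1 ℕ.≤ r
    → ((y : Fin N) → _≤_ ((+ b y / 1) * ((_/_ (+ dot N a b) S {{>-nonZero S>0}}) ^ℚ (r ∸ 1))) (ChungLu.𝔼 N a b S {{>-nonZero S>0}} (λ G → pathsFrom G r y)))
      × _≤_ ((+ S / 1) * ((_/_ (+ dot N a b) S {{>-nonZero S>0}}) ^ℚ (r ∸ 1))) (ChungLu.𝔼 N a b S {{>-nonZero S>0}} (λ G → paths G r))
lemma2 N a b S S>0 a-total b-total ab≤S (suc r) _ = E-pathsFrom r , E-paths r
  where open ChungLuPaths N a b S {{>-nonZero S>0}} a-total b-total ab≤S
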